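{- There are infinitely many odd positive integers $N$ for which there are no palindromic numbers $A, B$ with $N = A/B$.
   Context: A palindromic number is a positive integer whose base-$2$ representation (written without leading zeros) reads the same forwards and backwards. -}

module Defs where

open import Data.Nat using (ℕ; zero; suc; _<_; _%_; _/_)
open import Data.Bool using (Bool; true; false)
open import Data.List using (List; []; _∷_; reverse)
open import Data.Nat.Properties using (_≟_)
open import Relation.Binary.PropositionalEquality using (_≡_)
open import Data.Product using (_×_)

-- Binary digits, least significant first, without leading zeros.
-- The first argument is fuel (using n itself as fuel suffices since n / 2 < n).
binDigitsAux : ℕ → ℕ → List ℕ
binDigitsAux zero    n       = []
binDigitsAux (suc f) zero    = []
binDigitsAux (suc f) (suc n) = (suc n % 2) ∷ binDigitsAux f (suc n / 2)

binDigits : ℕ → List ℕ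
binDigits n = binDigitsAux n n

Palindromic : ℕ → Set
Palindromic n = (0 < n) × (reverse (binDigits n) ≡ binDigits n)

-- Since N ≡ 1 (mod 8), A = N B forces A ≡ B (mod 8): the two palindromes end in the same three
-- binary digits, hence, read backwards, begin with the same three digits t ∈ {4, …, 7}. Both then
-- lie in intervals [t 2^e, (t+1) 2^e), so A / B is within a factor (t+1)/t ≤ 5/4 of a power of two.
-- N = 1 + 24·2^m is not: it lies strictly between 1.5·2^(m+4) and 1.75·2^(m+4).
module Submission where

open import Defs
open import Data.Nat using (ℕ; zero; suc; _+_; _*_; _^_; _%_; _/_; _⊔_; _≤_; _<_; z≤n; s≤s; NonZero)
open import Data.Nat.Properties
open import Data.Nat.DivMod using (/-monoˡ-≤; m/n<m; m%n<n; m≡m%n+[m/n]*n; m/n*n≤m; m*n/n≡m; [m+kn]%n≡m%n; +-distrib-/-∣ʳ)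
open import Data.Nat.Divisibility using (divides-refl)
open import Data.Nat.Tactic.RingSolver using (solve-∀)
open import Data.List using (List; []; _∷_; reverse; length; _++_)
open import Data.List.Properties using (reverse-++; length-reverse)
open import Data.List.Relation.Unary.All using (All; []; _∷_)
open import Data.List.Relation.Unary.All.Properties using (++⁻ˡ)
open import Data.Product using (Σ; _×_; _,_; proj₁; proj₂)
open import Relation.Binary.PropositionalEquality using (_≡_; refl; sym; trans; cong; cong₂; subst; module ≡-Reasoning)
open import Relation.Nullary using (¬_)
open import Data.Empty using (⊥)
open import Data.Sum using ([_,_]′)

fromBits : List ℕ → ℕ
fromBits []       = 0
fromBits (b ∷ bs) = b + 2 * fromBits bs

Bits : List ℕ → Set
Bits = All (_< 2)

fromBits-++ : ∀ lo hi → fromBits (lo ++ hi) ≡ fromBits lo + 2 ^ length lo * fromBits hi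
fromBits-++ []       hi = sym (*-identityˡ (fromBits hi))
fromBits-++ (b ∷ lo) hi = begin
  b + 2 * fromBits (lo ++ hi)                               ≡⟨ cong (λ v → b + 2 * v) (fromBits-++ lo hi) ⟩
  b + 2 * (fromBits lo + 2 ^ length lo * fromBits hi)       ≡⟨ regroup b (fromBits lo) (2 ^ length lo) (fromBits hi) ⟩
  b + 2 * fromBits lo + 2 * 2 ^ length lo * fromBits hi     ∎
  where
  open ≡-Reasoning
  regroup : ∀ x y p z → x + 2 * (y + p * z) ≡ x + 2 * y + 2 * p * z
  regroup = solve-∀

fromBits<2^length : ∀ {bs} → Bits bs → fromBits bs < 2 ^ length bs
fromBits<2^length {[]}     []           = s≤s z≤n
fromBits<2^length {b ∷ bs} (b<2 ∷ bits) = begin-strict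
  b + 2 * fromBits bs        <⟨ +-monoˡ-≤ (2 * fromBits bs) b<2 ⟩
  2 + 2 * fromBits bs        ≡⟨ *-suc 2 (fromBits bs) ⟨
  2 * suc (fromBits bs)      ≤⟨ *-monoʳ-≤ 2 (fromBits<2^length bits) ⟩
  2 * 2 ^ length bs          ∎
  where open ≤-Reasoning

fromBits-++-bounds : ∀ {lo} hi → Bits lo →
  fromBits hi * 2 ^ length lo ≤ fromBits (lo ++ hi) × fromBits (lo ++ hi) < suc (fromBits hi) * 2 ^ length lo
fromBits-++-bounds {lo} hi bits rewrite fromBits-++ lo hi | *-comm (fromBits hi) (2 ^ length lo) =
  m≤n+m _ (fromBits lo) , +-monoˡ-< _ (fromBits<2^length bits)

half≤ : ∀ n → suc n / 2 ≤ n
half≤ n = ≤-pred (m/n<m (suc n) 2 (s≤s (s≤s z≤n)))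

binDigitsAux-fuel : ∀ {f g} n → n ≤ f → n ≤ g → binDigitsAux f n ≡ binDigitsAux g n
binDigitsAux-fuel {zero}  {zero}  zero    _         _         = refl
binDigitsAux-fuel {zero}  {suc g} zero    _         _         = refl
binDigitsAux-fuel {suc f} {zero}  zero    _         _         = refl
binDigitsAux-fuel {suc f} {suc g} zero    _         _         = refl
binDigitsAux-fuel {suc f} {suc g} (suc n) (s≤s n≤f) (s≤s n≤g) =
  cong (suc n % 2 ∷_) (binDigitsAux-fuel (suc n / 2) (≤-trans (half≤ n) n≤f) (≤-trans (half≤ n) n≤g))

binDigits-pos : ∀ {n} → 0 < n → binDigits n ≡ n % 2 ∷ binDigits (n / 2)
binDigits-pos {suc n} _ = cong (suc n % 2 ∷_) (binDigitsAux-fuel (suc n / 2) (half≤ n) ≤-refl)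

fromBits-binDigitsAux : ∀ f n → n ≤ f → fromBits (binDigitsAux f n) ≡ n
fromBits-binDigitsAux zero    zero    _         = refl
fromBits-binDigitsAux (suc f) zero    _         = refl
fromBits-binDigitsAux (suc f) (suc n) (s≤s n≤f) = begin
  suc n % 2 + 2 * fromBits (binDigitsAux f (suc n / 2))  ≡⟨ cong (λ v → suc n % 2 + 2 * v) (fromBits-binDigitsAux f (suc n / 2) (≤-trans (half≤ n) n≤f)) ⟩
  suc n % 2 + 2 * (suc n / 2)                            ≡⟨ cong (suc n % 2 +_) (*-comm 2 (suc n / 2)) ⟩
  suc n % 2 + suc n / 2 * 2                              ≡⟨ m≡m%n+[m/n]*n (suc n) 2 ⟨
  suc n                                                  ∎
  where open ≡-Reasoning

fromBits-binDigits : ∀ n → fromBits (binDigits n) ≡ n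
fromBits-binDigits n = fromBits-binDigitsAux n n ≤-refl

binDigitsAux-bits : ∀ f n → Bits (binDigitsAux f n)
binDigitsAux-bits zero    n       = []
binDigitsAux-bits (suc f) zero    = []
binDigitsAux-bits (suc f) (suc n) = m%n<n (suc n) 2 ∷ binDigitsAux-bits f (suc n / 2)

binDigits-bits : ∀ n → Bits (binDigits n)
binDigits-bits n = binDigitsAux-bits n n

-- The bound is stated with ⊔ 1 so that it also holds at 0, which is where the recursion stops.
2^length-binDigitsAux : ∀ f n → n ≤ f → 2 ^ length (binDigitsAux f n) ≤ 2 * n ⊔ 1
2^length-binDigitsAux zero    zero    _         = ≤-refl
2^length-binDigitsAux (suc f) zero    _         = ≤-refl
2^length-binDigitsAux (suc f) (suc n) (s≤s n≤f) = begin
  2 * 2 ^ length (binDigitsAux f (suc n / 2))  ≤⟨ *-monoʳ-≤ 2 (2^length-binDigitsAux f (suc n / 2) (≤-trans (half≤ n) n≤f)) ⟩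
  2 * (2 * (suc n / 2) ⊔ 1)                   ≤⟨ *-monoʳ-≤ 2 (⊔-lub twice-half≤ (s≤s z≤n)) ⟩
  2 * suc n                                   ≤⟨ m≤m⊔n (2 * suc n) 1 ⟩
  2 * suc n ⊔ 1                               ∎
  where
  open ≤-Reasoning
  twice-half≤ : 2 * (suc n / 2) ≤ suc n
  twice-half≤ = subst (_≤ suc n) (*-comm (suc n / 2) 2) (m/n*n≤m (suc n) 2)

2^length-binDigits≤2* : ∀ {n} → 0 < n → 2 ^ length (binDigits n) ≤ 2 * n
2^length-binDigits≤2* {n} 0<n =
  subst (2 ^ length (binDigits n) ≤_) (m≥n⇒m⊔n≡m (≤-trans 0<n (m≤n*m n 2))) (2^length-binDigitsAux n n ≤-refl)

lowBits3 : ℕ → List ℕ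
lowBits3 X = X % 2 ∷ X / 2 % 2 ∷ X / 2 / 2 % 2 ∷ []

reversedLowBits3 : ℕ → ℕ
reversedLowBits3 X = fromBits (reverse (lowBits3 X))

binDigits-lowBits3 : ∀ {X} → 4 ≤ X → binDigits X ≡ lowBits3 X ++ binDigits (X / 2 / 2 / 2)
binDigits-lowBits3 {X} 4≤X = begin
  binDigits X                                                      ≡⟨ binDigits-pos (≤-trans (s≤s z≤n) 4≤X) ⟩
  X % 2 ∷ binDigits (X / 2)                                        ≡⟨ cong (X % 2 ∷_) (binDigits-pos (≤-trans (s≤s z≤n) 2≤X/2)) ⟩
  X % 2 ∷ X / 2 % 2 ∷ binDigits (X / 2 / 2)                        ≡⟨ cong (λ ds → X % 2 ∷ X / 2 % 2 ∷ ds) (binDigits-pos 1≤X/4) ⟩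
  X % 2 ∷ X / 2 % 2 ∷ X / 2 / 2 % 2 ∷ binDigits (X / 2 / 2 / 2)    ∎
  where
  open ≡-Reasoning
  2≤X/2 : 2 ≤ X / 2
  2≤X/2 = /-monoˡ-≤ 2 4≤X
  1≤X/4 : 1 ≤ X / 2 / 2
  1≤X/4 = /-monoˡ-≤ 2 2≤X/2

half-+*2 : ∀ X k → (X + k * 2) / 2 ≡ X / 2 + k
half-+*2 X k = trans (+-distrib-/-∣ʳ X (divides-refl k)) (cong (X / 2 +_) (m*n/n≡m k 2))

lowBits3-+*8 : ∀ X k → lowBits3 (X + k * 8) ≡ lowBits3 X
lowBits3-+*8 X k = cong₂ _∷_ bit₀ (cong₂ _∷_ bit₁ (cong (_∷ []) bit₂))
  where
  open ≡-Reasoning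
  even-shift : ∀ Y j → (Y + j * 2) % 2 ≡ Y % 2
  even-shift Y j = [m+kn]%n≡m%n Y j 2
  X+k*8≡ : X + k * 8 ≡ X + k * 4 * 2
  X+k*8≡ = cong (X +_) (sym (*-assoc k 4 2))
  half : (X + k * 8) / 2 ≡ X / 2 + k * 2 * 2
  half = begin
    (X + k * 8) / 2        ≡⟨ cong (_/ 2) X+k*8≡ ⟩
    (X + k * 4 * 2) / 2    ≡⟨ half-+*2 X (k * 4) ⟩
    X / 2 + k * 4          ≡⟨ cong (X / 2 +_) (*-assoc k 2 2) ⟨
    X / 2 + k * 2 * 2      ∎
  quarter : (X + k * 8) / 2 / 2 ≡ X / 2 / 2 + k * 2
  quarter = trans (cong (_/ 2) half) (half-+*2 (X / 2) (k * 2))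
  bit₀ : (X + k * 8) % 2 ≡ X % 2
  bit₀ = trans (cong (_% 2) X+k*8≡) (even-shift X (k * 4))
  bit₁ : (X + k * 8) / 2 % 2 ≡ X / 2 % 2
  bit₁ = trans (cong (_% 2) half) (even-shift (X / 2) (k * 2))
  bit₂ : (X + k * 8) / 2 / 2 % 2 ≡ X / 2 / 2 % 2
  bit₂ = trans (cong (_% 2) quarter) (even-shift (X / 2 / 2) k)

palindromic-leading-bounds : ∀ {X} → 4 ≤ X → reverse (binDigits X) ≡ binDigits X →
  Σ ℕ λ k → reversedLowBits3 X * 2 ^ k ≤ X × X < suc (reversedLowBits3 X) * 2 ^ k × 2 ^ (3 + k) ≤ 2 * X
palindromic-leading-bounds {X} 4≤X pal = length lo , lower , upper , long
  where
  open ≡-Reasoning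
  r lo : List ℕ
  r  = binDigits (X / 2 / 2 / 2)
  lo = reverse r
  mirrored : binDigits X ≡ lo ++ reverse (lowBits3 X)
  mirrored = begin
    binDigits X                  ≡⟨ pal ⟨
    reverse (binDigits X)        ≡⟨ cong reverse (binDigits-lowBits3 4≤X) ⟩
    reverse (lowBits3 X ++ r)    ≡⟨ reverse-++ (lowBits3 X) r ⟩
    lo ++ reverse (lowBits3 X)   ∎
  value : fromBits (lo ++ reverse (lowBits3 X)) ≡ X
  value = trans (cong fromBits (sym mirrored)) (fromBits-binDigits X)
  loBits : Bits lo
  loBits = ++⁻ˡ lo (subst Bits mirrored (binDigits-bits X))
  lower : reversedLowBits3 X * 2 ^ length lo ≤ X
  lower = subst (reversedLowBits3 X * 2 ^ length lo ≤_) value (proj₁ (fromBits-++-bounds _ loBits))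
  upper : X < suc (reversedLowBits3 X) * 2 ^ length lo
  upper = subst (_< suc (reversedLowBits3 X) * 2 ^ length lo) value (proj₂ (fromBits-++-bounds _ loBits))
  long : 2 ^ (3 + length lo) ≤ 2 * X
  long = subst (_≤ 2 * X)
    (trans (cong (λ ds → 2 ^ length ds) (binDigits-lowBits3 4≤X)) (cong (λ n → 2 ^ (3 + n)) (sym (length-reverse r))))
    (2^length-binDigits≤2* (≤-trans (s≤s z≤n) 4≤X))

-- t is the value of the three leading binary digits of 4 X; the factor 4 covers the palindromes 1 and 3,
-- which have fewer than three digits.
LeadsWith : ℕ → ℕ → Set
LeadsWith t X = Σ ℕ λ e → t * 2 ^ e ≤ 4 * X × 4 * X < suc t * 2 ^ e

palindromic-leadsWith : ∀ {X} → Palindromic X → 4 ≤ reversedLowBits3 X × LeadsWith (reversedLowBits3 X) X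
palindromic-leadsWith {0} (() , _)
palindromic-leadsWith {1} _        = ≤-refl , 0 , ≤-refl , ≤-refl
palindromic-leadsWith {2} (_ , ())
palindromic-leadsWith {3} _        = s≤s (s≤s (s≤s (s≤s z≤n))) , 1 , ≤-refl , n≤1+n 13
palindromic-leadsWith {X@(suc (suc (suc (suc _))))} (_ , pal)
  with k , lower , upper , long ← palindromic-leading-bounds (s≤s (s≤s (s≤s (s≤s z≤n)))) pal =
  4≤t , 2 + k , subst (_≤ 4 * X) (quadruple t P) (*-monoʳ-≤ 4 lower) ,
  subst (4 * X <_) (quadruple (suc t) P) (*-monoʳ-< 4 upper)
  where
  t : ℕ
  t = reversedLowBits3 X
  P : ℕ
  P = 2 ^ k
  quadruple : ∀ u P → 4 * (u * P) ≡ u * (2 * (2 * P))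
  quadruple = solve-∀
  4P≤X : 4 * P ≤ X
  4P≤X = subst (_≤ X) (sym (*-assoc 2 2 P)) (*-cancelˡ-≤ 2 long)
  4≤t : 4 ≤ t
  4≤t = ≤-pred (*-cancelʳ-< P 4 (suc t) (≤-<-trans 4P≤X upper))

NearPowerOfTwo : ℕ → Set
NearPowerOfTwo N = Σ ℕ λ r → Σ ℕ λ s → 4 * (N * 2 ^ r) < 5 * 2 ^ s × 4 * 2 ^ s < 5 * (N * 2 ^ r)

*-exchange : ∀ a b c → a * (b * c) ≡ b * (a * c)
*-exchange = solve-∀

*<suc*⇒4*<5* : ∀ {t x y} → 4 ≤ t → t * x < suc t * y → 4 * x < 5 * y
*<suc*⇒4*<5* {t} {x} {y} 4≤t tx<[1+t]y = *-cancelˡ-< t (4 * x) (5 * y) (begin-strict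
  t * (4 * x)       ≡⟨ *-exchange t 4 x ⟩
  4 * (t * x)       <⟨ *-monoʳ-< 4 tx<[1+t]y ⟩
  4 * (suc t * y)   ≡⟨ *-assoc 4 (suc t) y ⟨
  4 * suc t * y     ≤⟨ *-monoˡ-≤ y (subst (_≤ 5 * t) (sym (*-suc 4 t)) (+-monoˡ-≤ (4 * t) 4≤t)) ⟩
  5 * t * y         ≡⟨ trans (*-assoc 5 t y) (*-exchange 5 t y) ⟩
  t * (5 * y)       ∎)
  where open ≤-Reasoning

leadsWith-ratio : ∀ {t N B} .{{_ : NonZero N}} → 4 ≤ t → LeadsWith t (N * B) → LeadsWith t B → NearPowerOfTwo N
leadsWith-ratio {t} {N} {B} 4≤t (e , lowerNB , upperNB) (e′ , lowerB , upperB) =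
  e′ , e , *<suc*⇒4*<5* 4≤t below , *<suc*⇒4*<5* 4≤t above
  where
  open ≤-Reasoning
  below : t * (N * 2 ^ e′) < suc t * 2 ^ e
  below = begin-strict
    t * (N * 2 ^ e′)   ≡⟨ *-exchange t N (2 ^ e′) ⟩
    N * (t * 2 ^ e′)   ≤⟨ *-monoʳ-≤ N lowerB ⟩
    N * (4 * B)        ≡⟨ *-exchange N 4 B ⟩
    4 * (N * B)        <⟨ upperNB ⟩
    suc t * 2 ^ e      ∎
  above : t * 2 ^ e < suc t * (N * 2 ^ e′)
  above = begin-strict
    t * 2 ^ e              ≤⟨ lowerNB ⟩
    4 * (N * B)            ≡⟨ *-exchange 4 N B ⟩
    N * (4 * B)            <⟨ *-monoʳ-< N upperB ⟩
    N * (suc t * 2 ^ e′)   ≡⟨ *-exchange N (suc t) (2 ^ e′) ⟩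
    suc t * (N * 2 ^ e′)   ∎

palindromic-multiple⇒nearPowerOfTwo : ∀ j {A B} → Palindromic A → Palindromic B → A ≡ (1 + j * 8) * B →
  NearPowerOfTwo (1 + j * 8)
palindromic-multiple⇒nearPowerOfTwo j {B = B} palA palB refl =
  leadsWith-ratio {N = 1 + j * 8} {B} 4≤t (subst (λ t → LeadsWith t ((1 + j * 8) * B)) sameLead leadsA) leadsB
  where
  regroup : ∀ j B → j * 8 * B ≡ j * B * 8
  regroup = solve-∀
  sameLead : reversedLowBits3 ((1 + j * 8) * B) ≡ reversedLowBits3 B
  sameLead = cong (λ bs → fromBits (reverse bs))
    (trans (cong (λ v → lowBits3 (B + v)) (regroup j B)) (lowBits3-+*8 B (j * B)))
  leadsA : LeadsWith (reversedLowBits3 ((1 + j * 8) * B)) ((1 + j * 8) * B)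
  leadsA = proj₂ (palindromic-leadsWith palA)
  4≤t : 4 ≤ reversedLowBits3 B
  4≤t = proj₁ (palindromic-leadsWith palB)
  leadsB : LeadsWith (reversedLowBits3 B) B
  leadsB = proj₂ (palindromic-leadsWith palB)

¬nearPowerOfTwo-1+24·2^m : ∀ m → ¬ NearPowerOfTwo (1 + 3 * 2 ^ m * 8)
¬nearPowerOfTwo-1+24·2^m m (r , s , below , above) = [ tooSmall , tooLarge ]′ (≤-<-connex s (r + (4 + m)))
  where
  open ≤-Reasoning
  Q P N : ℕ
  Q = 2 ^ m
  P = 2 ^ r
  N = 1 + 3 * Q * 8
  split : ∀ Q P → 4 * ((1 + 3 * Q * 8) * P) ≡ 5 * (P * (2 * (2 * (2 * (2 * Q))))) + (4 + 16 * Q) * P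
  split = solve-∀
  expand : ∀ Q P → 5 * ((1 + 3 * Q * 8) * P) ≡ (5 + 120 * Q) * P
  expand = solve-∀
  collect : ∀ Q P → (8 * Q + 120 * Q) * P ≡ 4 * (2 * (P * (2 * (2 * (2 * (2 * Q))))))
  collect = solve-∀
  tooSmall : s ≤ r + (4 + m) → ⊥
  tooSmall s≤ = <⇒≱ below (begin
    5 * 2 ^ s                                  ≤⟨ *-monoʳ-≤ 5 (subst (2 ^ s ≤_) (^-distribˡ-+-* 2 r (4 + m)) (^-monoʳ-≤ 2 s≤)) ⟩
    5 * (P * 2 ^ (4 + m))                      ≤⟨ m≤m+n _ _ ⟩
    5 * (P * 2 ^ (4 + m)) + (4 + 16 * Q) * P   ≡⟨ split Q P ⟨
    4 * (N * P)                                ∎)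
  tooLarge : r + (4 + m) < s → ⊥
  tooLarge <s = <⇒≱ above (begin
    5 * (N * P)                   ≡⟨ expand Q P ⟩
    (5 + 120 * Q) * P             ≤⟨ *-monoˡ-≤ P (+-monoˡ-≤ (120 * Q) (≤-trans 5≤8 (*-monoʳ-≤ 8 (m^n>0 2 m)))) ⟩
    (8 * Q + 120 * Q) * P         ≡⟨ collect Q P ⟩
    4 * (2 * (P * 2 ^ (4 + m)))   ≤⟨ *-monoʳ-≤ 4 (subst (_≤ 2 ^ s) (cong (2 *_) (^-distribˡ-+-* 2 r (4 + m))) (^-monoʳ-≤ 2 <s)) ⟩
    4 * 2 ^ s                     ∎)
    where
    5≤8 : 5 ≤ 8
    5≤8 = s≤s (s≤s (s≤s (s≤s (s≤s z≤n))))

n<2^n : ∀ n → n < 2 ^ n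
n<2^n zero    = s≤s z≤n
n<2^n (suc n) = ≤-<-trans (n<2^n n) (subst (2 ^ n <_) (*-comm (2 ^ n) 2) (m<m*n (2 ^ n) 2 {{m^n≢0 2 n}} (s≤s (s≤s z≤n))))

theorem8 : (m : ℕ) → Σ ℕ (λ N → (m ≤ N) × (Σ ℕ (λ k → N ≡ 2 * k + 1)) × (¬ (Σ ℕ (λ A → Σ ℕ (λ B → Palindromic A × Palindromic B × (A ≡ N * B))))))
theorem8 m = 1 + j * 8 , m≤N , (j * 4 , odd j) , noPalindromicRatio
  where
  j : ℕ
  j = 3 * 2 ^ m
  odd : ∀ j → 1 + j * 8 ≡ 2 * (j * 4) + 1
  odd = solve-∀
  m≤N : m ≤ 1 + j * 8
  m≤N = ≤-trans (<⇒≤ (n<2^n m)) (≤-trans (m≤n*m (2 ^ m) 3) (≤-trans (m≤m*n j 8) (n≤1+n (j * 8))))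
  noPalindromicRatio : ¬ Σ ℕ (λ A → Σ ℕ (λ B → Palindromic A × Palindromic B × (A ≡ (1 + j * 8) * B)))
  noPalindromicRatio (A , B , palA , palB , A≡NB) = ¬nearPowerOfTwo-1+24·2^m m (palindromic-multiple⇒nearPowerOfTwo j palA palB A≡NB)
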